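{- Let $\Gamma=\mathrm{Cay}(G,S)$ be a Cayley graph with girth $g>4$. Suppose that $S$ contains an element of order $m$, with $m>2$. Then $g\le m$ and the vertex set of $\Gamma$ can be partitioned into sets each inducing an $m$-cycle in $\Gamma$.
   Context: For a finite group $G$ with identity $e$ and an inverse-closed subset $S\subseteq G\setminus\{e\}$, the Cayley graph $\mathrm{Cay}(G,S)$ has vertex set $G$, with $a,b$ adjacent iff $ab^{ -1}\in S$. -}

module Defs where

open import Level using (Level; _⊔_)
open import Algebra.Bundles using (Group)
open import Data.Nat using (ℕ; zero; suc; _<_; _≤_)
open import Data.Fin using (Fin; toℕ)
open import Data.Nat.DivMod using (_%_)
open import Data.Product using (Σ; ∃; ∃₂; _×_; _,_)
open import Data.Sum using (_⊎_)
open import Relation.Nullary using (¬_)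
import Data.Empty.Polymorphic as P
open import Relation.Binary.Definitions using (Decidable)
open import Relation.Binary.PropositionalEquality using (_≡_)

module CayleyDefs {c ℓ : Level} (G : Group c ℓ) where
  open Group G

  _^_ : Carrier → ℕ → Carrier
  x ^ zero  = ε
  x ^ suc k = x ∙ (x ^ k)

  IsFiniteGroup : Set (c ⊔ ℓ)
  IsFiniteGroup = Decidable _≈_ × (Σ ℕ λ n → Σ (Fin n → Carrier) λ f → ∀ x → ∃ λ i → x ≈ f i)

  HasOrder : Carrier → ℕ → Set ℓ
  HasOrder x m = 0 < m × (x ^ m) ≈ ε × (∀ k → 0 < k → k < m → ¬ ((x ^ k) ≈ ε))

  record ConnectionSet {p : Level} (S : Carrier → Set p) : Set (c ⊔ ℓ ⊔ p) where
    field
      respects   : ∀ {x y} → x ≈ y → S x → S y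
      no-identity : ¬ S ε
      inv-closed : ∀ {x} → S x → S (x ⁻¹)

  module _ {p : Level} (S : Carrier → Set p) where

    Adj : Carrier → Carrier → Set p
    Adj a b = S (a ∙ (b ⁻¹))

    next : ∀ {k} → Fin (suc k) → ℕ
    next {k} i = suc (toℕ i) % suc k

    -- A cycle of length k in Cay(G,S): k ≥ 3 pairwise distinct vertices
    -- v₀,…,v_{k-1} with v_i ~ v_{i+1 mod k}.
    IsCycle : (k : ℕ) → (Fin k → Carrier) → Set (ℓ ⊔ p)
    IsCycle zero v = P.⊥
    IsCycle (suc k) v =
      2 ≤ k × (∀ i j → v i ≈ v j → i ≡ j) × (∀ i j → next i ≡ toℕ j → Adj (v i) (v j))

    HasCycleOfLength : ℕ → Set (c ⊔ ℓ ⊔ p)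
    HasCycleOfLength k = ∃ λ (v : Fin k → Carrier) → IsCycle k v

    -- girth(Γ) > b  (girth = least length of a cycle, ∞ if acyclic)
    GirthGreaterThan : ℕ → Set (c ⊔ ℓ ⊔ p)
    GirthGreaterThan b = ∀ k → k ≤ b → ¬ HasCycleOfLength k

    GirthAtMost : ℕ → Set (c ⊔ ℓ ⊔ p)
    GirthAtMost b = ∃ λ k → k ≤ b × HasCycleOfLength k

    -- The vertices v₀,…,v_{m-1} (m ≥ 3) are distinct and induce an m-cycle:
    -- v_i ~ v_j iff j = i+1 mod m or i = j+1 mod m.
    InducesCycle : (m : ℕ) → (Fin m → Carrier) → Set (ℓ ⊔ p)
    InducesCycle zero v = P.⊥
    InducesCycle (suc k) v =
      2 ≤ k × (∀ i j → v i ≈ v j → i ≡ j)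
        × (∀ i j → (Adj (v i) (v j) → (next i ≡ toℕ j ⊎ next j ≡ toℕ i))
                  × ((next i ≡ toℕ j ⊎ next j ≡ toℕ i) → Adj (v i) (v j)))

    -- The vertex set G is partitioned into r sets, the i-th being
    -- {C i 0, …, C i (m-1)}, each inducing an m-cycle.
    PartitionIntoInducedCycles : ℕ → Set (c ⊔ ℓ ⊔ p)
    PartitionIntoInducedCycles m =
      Σ ℕ λ r → Σ (Fin r → Fin m → Carrier) λ C →
        (∀ i → InducesCycle m (C i))
        × (∀ x → ∃₂ λ i j → x ≈ C i j)
        × (∀ i i′ j j′ → C i j ≈ C i′ j′ → i ≡ i′)

-- If s ∈ S has order m, then s and s⁻¹ are the only elements of ⟨s⟩ in S:
-- any t ∈ S commuting with s, with t ∉ {s, s⁻¹}, closes the 4-cycle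
-- e, s, t s, t, which girth > 4 forbids. Hence two vertices s^i x and s^j x
-- of a right coset ⟨s⟩x are adjacent exactly when i − j ≡ ±1 (mod m), so
-- every right coset of ⟨s⟩ induces an m-cycle, and the right cosets
-- partition G.
module Submission where

open import Defs
open import Level using (Level; _⊔_)
open import Algebra.Bundles using (Group)
open import Data.Nat using (ℕ; zero; suc; _+_; _*_; _∸_; _<_; _≤_; z≤n; s≤s)
open import Data.Nat.Properties
  using (+-comm; ≤-refl; ≤-pred; <⇒≤; <-cmp; ≤-<-trans; m∸n≤m; m∸n+n≡m; m<n⇒0<n∸m)
open import Data.Nat.DivMod using (_%_; _/_; m%n<n; m≡m%n+[m/n]*n)
open import Data.Fin as Fin using (Fin; toℕ)
open import Data.Fin.Patterns using (0F; 1F; 2F; 3F)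
open import Data.Fin.Properties as Finₚ using (toℕ-injective; toℕ<n; toℕ-fromℕ<; any?; all?)
open import Data.Product using (Σ; ∃; ∃₂; _×_; _,_; proj₁; proj₂)
open import Data.Sum as Sum using (_⊎_; inj₁; inj₂)
open import Data.Empty using (⊥-elim)
open import Data.List using (List; length; lookup; filter; allFin)
open import Data.List.Relation.Unary.All as All using ()
open import Data.List.Relation.Unary.All.Properties using (all-filter)
open import Data.List.Relation.Unary.Any using (index)
open import Data.List.Relation.Unary.Any.Properties using (lookup-index)
open import Data.List.Relation.Unary.AllPairs using (_∷_)
open import Data.List.Relation.Unary.Unique.Propositional using (Unique)
open import Data.List.Relation.Unary.Unique.Propositional.Properties using (allFin⁺; filter⁺)
open import Data.List.Membership.Propositional using (_∈_)
open import Data.List.Membership.Propositional.Properties using (∈-filter⁺; ∈-allFin; ∈-lookup)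
open import Relation.Nullary using (¬_; Dec; yes; no)
open import Relation.Nullary.Decidable using (¬?; _→-dec_)
open import Relation.Unary using (Pred)
open import Relation.Binary.Definitions using (Decidable; tri<; tri≈; tri>)
open import Relation.Binary.PropositionalEquality as ≡ using (_≡_; cong; subst)

lookup-injective : ∀ {a} {A : Set a} {xs : List A} → Unique xs →
                   ∀ i j → lookup xs i ≡ lookup xs j → i ≡ j
lookup-injective (x∉xs ∷ _) Fin.zero    Fin.zero    _  = ≡.refl
lookup-injective (x∉xs ∷ _) Fin.zero    (Fin.suc j) eq = ⊥-elim (All.lookup x∉xs (∈-lookup j) eq)
lookup-injective (x∉xs ∷ _) (Fin.suc i) Fin.zero    eq = ⊥-elim (All.lookup x∉xs (∈-lookup i) (≡.sym eq))
lookup-injective (_ ∷ uniq) (Fin.suc i) (Fin.suc j) eq = cong Fin.suc (lookup-injective uniq i j eq)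

smallest : ∀ {n p} {P : Pred (Fin n) p} → (∀ i → Dec (P i)) →
           ∀ i → P i → ∃ λ j → P j × (∀ k → k Fin.< j → ¬ P k)
smallest {suc n} P? i Pi with P? Fin.zero
... | yes P0 = Fin.zero , P0 , λ _ ()
smallest {suc n} P? Fin.zero    P0 | no ¬P0 = ⊥-elim (¬P0 P0)
smallest {suc n} P? (Fin.suc i) Pi | no ¬P0
  with j , Pj , below ← smallest (λ k → P? (Fin.suc k)) i Pi =
  Fin.suc j , Pj , λ { Fin.zero _ → ¬P0 ; (Fin.suc k) (s≤s k<j) → below k k<j }

module GroupProperties {c ℓ} (G : Group c ℓ) where
  open Group G
  open CayleyDefs G using (_^_; HasOrder)
  open import Algebra.Properties.Group G
  open import Relation.Binary.Reasoning.Setoid setoid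

  ^-homo-+ : ∀ x a b → x ^ (a + b) ≈ x ^ a ∙ x ^ b
  ^-homo-+ x zero    b = sym (identityˡ _)
  ^-homo-+ x (suc a) b = trans (∙-congˡ (^-homo-+ x a b)) (sym (assoc _ _ _))

  ^-congʳ : ∀ x {a b} → a ≡ b → x ^ a ≈ x ^ b
  ^-congʳ x eq = reflexive (cong (x ^_) eq)

  ^-comm : ∀ x a → x ^ a ∙ x ≈ x ∙ x ^ a
  ^-comm x a = begin
    x ^ a ∙ x         ≈⟨ ∙-congˡ (identityʳ x) ⟨
    x ^ a ∙ x ^ 1     ≈⟨ ^-homo-+ x a 1 ⟨
    x ^ (a + 1)       ≈⟨ ^-congʳ x (+-comm a 1) ⟩
    x ^ suc a         ∎

  //-cancelʳ : ∀ x y z → (x ∙ z) // (y ∙ z) ≈ x // y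
  //-cancelʳ x y z = begin
    (x ∙ z) ∙ (y ∙ z) ⁻¹        ≈⟨ ∙-congˡ (⁻¹-anti-homo-∙ y z) ⟩
    (x ∙ z) ∙ (z ⁻¹ ∙ y ⁻¹)     ≈⟨ assoc x z _ ⟩
    x ∙ (z ∙ (z ⁻¹ ∙ y ⁻¹))     ≈⟨ ∙-congˡ (\\-leftDividesˡ z (y ⁻¹)) ⟩
    x ∙ y ⁻¹                    ∎

  //≈⇒≈∙ : ∀ {x y z} → x // y ≈ z → x ≈ z ∙ y
  //≈⇒≈∙ {x} {y} eq = trans (sym (//-rightDividesˡ y x)) (∙-congʳ eq)

  //≈⁻¹⇒//≈ : ∀ {x y z} → x // y ≈ z ⁻¹ → y // x ≈ z
  //≈⁻¹⇒//≈ {x} {y} {z} eq = begin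
    y // x          ≈⟨ ⁻¹-anti-homo-// x y ⟨
    (x // y) ⁻¹     ≈⟨ ⁻¹-cong eq ⟩
    z ⁻¹ ⁻¹         ≈⟨ ⁻¹-involutive z ⟩
    z               ∎

  module Periodic {x : Carrier} {k : ℕ} (x^m≈ε : x ^ suc k ≈ ε) where

    ^-*-period : ∀ q → x ^ (q * suc k) ≈ ε
    ^-*-period zero    = refl
    ^-*-period (suc q) = begin
      x ^ (suc k + q * suc k)        ≈⟨ ^-homo-+ x (suc k) (q * suc k) ⟩
      x ^ suc k ∙ x ^ (q * suc k)    ≈⟨ ∙-cong x^m≈ε (^-*-period q) ⟩
      ε ∙ ε                          ≈⟨ identityˡ ε ⟩
      ε                              ∎

    ^-%-period : ∀ a → x ^ a ≈ x ^ (a % suc k)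
    ^-%-period a = begin
      x ^ a                                        ≈⟨ ^-congʳ x (m≡m%n+[m/n]*n a (suc k)) ⟩
      x ^ (a % suc k + (a / suc k) * suc k)        ≈⟨ ^-homo-+ x (a % suc k) _ ⟩
      x ^ (a % suc k) ∙ x ^ ((a / suc k) * suc k)  ≈⟨ ∙-congˡ (^-*-period (a / suc k)) ⟩
      x ^ (a % suc k) ∙ ε                          ≈⟨ identityʳ _ ⟩
      x ^ (a % suc k)                              ∎

    ^-⁻¹ : ∀ {a} → a ≤ suc k → (x ^ a) ⁻¹ ≈ x ^ (suc k ∸ a)
    ^-⁻¹ {a} a≤m = sym (inverseˡ-unique _ _ (begin
      x ^ (suc k ∸ a) ∙ x ^ a   ≈⟨ ^-homo-+ x (suc k ∸ a) a ⟨
      x ^ (suc k ∸ a + a)       ≈⟨ ^-congʳ x (m∸n+n≡m a≤m) ⟩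
      x ^ suc k                 ≈⟨ x^m≈ε ⟩
      ε                         ∎))

    ^-//-^ : ∀ a {b} → b ≤ suc k → x ^ a // x ^ b ≈ x ^ (a + (suc k ∸ b))
    ^-//-^ a b≤m = trans (∙-congˡ (^-⁻¹ b≤m)) (sym (^-homo-+ x a _))

  ^-distinct : ∀ {x m a b} → HasOrder x m → b < a → a < m → ¬ x ^ a ≈ x ^ b
  ^-distinct {x} {m} {a} {b} (_ , _ , minimal) b<a a<m eq =
    minimal (a ∸ b) (m<n⇒0<n∸m b<a) (≤-<-trans (m∸n≤m a b) a<m)
      (identityˡ-unique _ (x ^ b) (begin
        x ^ (a ∸ b) ∙ x ^ b  ≈⟨ ^-homo-+ x (a ∸ b) b ⟨
        x ^ (a ∸ b + b)      ≈⟨ ^-congʳ x (m∸n+n≡m (<⇒≤ b<a)) ⟩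
        x ^ a                ≈⟨ eq ⟩
        x ^ b                ∎))

  ^-injective : ∀ {x m a b} → HasOrder x m → a < m → b < m → x ^ a ≈ x ^ b → a ≡ b
  ^-injective {a = a} {b} ord a<m b<m eq with <-cmp a b
  ... | tri< a<b _ _ = ⊥-elim (^-distinct ord a<b b<m (sym eq))
  ... | tri≈ _ a≡b _ = a≡b
  ... | tri> _ _ b<a = ⊥-elim (^-distinct ord b<a a<m eq)

module RightCosets {c ℓ} (G : Group c ℓ) (finite : CayleyDefs.IsFiniteGroup G)
  {s : Group.Carrier G} {k : ℕ} (s^m≈ε : Group._≈_ G (CayleyDefs._^_ G s (suc k)) (Group.ε G)) where
  open Group G
  open CayleyDefs G using (_^_)
  open GroupProperties G
  open Periodic {s} {k} s^m≈ε
  open import Algebra.Properties.Group G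
  open import Relation.Binary.Reasoning.Setoid setoid

  _∼_ : Carrier → Carrier → Set ℓ
  x ∼ y = ∃ λ j → x ≈ s ^ j ∙ y

  ∼-bounded : ∀ {x y} → x ∼ y → ∃ λ (j : Fin (suc k)) → x ≈ s ^ toℕ j ∙ y
  ∼-bounded (j , eq) = Fin.fromℕ< (m%n<n j (suc k)) ,
    trans eq (∙-congʳ (trans (^-%-period j)
      (^-congʳ s (≡.sym (toℕ-fromℕ< (m%n<n j (suc k)))))))

  ∼-refl : ∀ x → x ∼ x
  ∼-refl x = 0 , sym (identityˡ x)

  ∼-trans : ∀ {x y z} → x ∼ y → y ∼ z → x ∼ z
  ∼-trans {x} {y} {z} (a , x≈) (b , y≈) = a + b , (begin
    x                    ≈⟨ x≈ ⟩
    s ^ a ∙ y            ≈⟨ ∙-congˡ y≈ ⟩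
    s ^ a ∙ (s ^ b ∙ z)  ≈⟨ assoc _ _ _ ⟨
    s ^ a ∙ s ^ b ∙ z    ≈⟨ ∙-congʳ (^-homo-+ s a b) ⟨
    s ^ (a + b) ∙ z      ∎)

  ∼-sym : ∀ {x y} → x ∼ y → y ∼ x
  ∼-sym {x} {y} x∼y with j , x≈ ← ∼-bounded x∼y =
    suc k ∸ toℕ j , (begin
      y                                 ≈⟨ \\-leftDividesʳ (s ^ toℕ j) y ⟨
      (s ^ toℕ j) ⁻¹ ∙ (s ^ toℕ j ∙ y)  ≈⟨ ∙-cong (^-⁻¹ (<⇒≤ (toℕ<n j))) (sym x≈) ⟩
      s ^ (suc k ∸ toℕ j) ∙ x           ∎)

  _∼?_ : Decidable _∼_
  x ∼? y with any? (λ (j : Fin (suc k)) → proj₁ finite x (s ^ toℕ j ∙ y))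
  ... | yes (j , x≈) = yes (toℕ j , x≈)
  ... | no ¬x∼y     = no (λ x∼y → ¬x∼y (∼-bounded x∼y))

  record Transversal : Set (c ⊔ ℓ) where
    field
      size      : ℕ
      rep       : Fin size → Carrier
      covers    : ∀ x → ∃₂ λ i (j : Fin (suc k)) → x ≈ s ^ toℕ j ∙ rep i
      separates : ∀ i i′ (j j′ : Fin (suc k)) → s ^ toℕ j ∙ rep i ≈ s ^ toℕ j′ ∙ rep i′ → i ≡ i′

  open Σ (proj₂ finite) renaming (proj₁ to n; proj₂ to enumeration)
  open Σ enumeration renaming (proj₁ to f; proj₂ to surjective)

  IsLeader : Fin n → Set ℓ
  IsLeader i = ∀ j → j Fin.< i → ¬ f i ∼ f j

  isLeader? : ∀ i → Dec (IsLeader i)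
  isLeader? i = all? (λ j → (j Fin.<? i) →-dec ¬? (f i ∼? f j))

  leaders : List (Fin n)
  leaders = filter isLeader? (allFin n)

  ∼-leader : ∀ x → ∃ λ i → IsLeader i × x ∼ f i
  ∼-leader x with i₀ , x≈ ← surjective x
    with i , fi₀∼fi , below ← smallest (λ i → f i₀ ∼? f i) i₀ (∼-refl (f i₀)) =
    i , (λ j j<i fi∼fj → below j j<i (∼-trans fi₀∼fi fi∼fj)) ,
    ∼-trans (0 , trans x≈ (sym (identityˡ _))) fi₀∼fi

  leader-unique : ∀ {i i′} → IsLeader i → IsLeader i′ → f i ∼ f i′ → i ≡ i′
  leader-unique {i} {i′} lead lead′ fi∼fi′ with Finₚ.<-cmp i i′
  ... | tri< i<i′ _ _ = ⊥-elim (lead′ i i<i′ (∼-sym fi∼fi′))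
  ... | tri≈ _ i≡i′ _ = i≡i′
  ... | tri> _ _ i′<i = ⊥-elim (lead i′ i′<i fi∼fi′)

  lookup-leaders : ∀ i → IsLeader (lookup leaders i)
  lookup-leaders i = All.lookup (all-filter isLeader? (allFin n)) (∈-lookup i)

  transversal : Transversal
  transversal = record
    { size      = length leaders
    ; rep       = λ i → f (lookup leaders i)
    ; covers    = covers
    ; separates = λ i i′ j j′ eq → lookup-injective (filter⁺ isLeader? (allFin⁺ n)) i i′
        (leader-unique (lookup-leaders i) (lookup-leaders i′)
          (∼-trans (∼-sym (toℕ j , refl)) (toℕ j′ , eq)))
    }
    where
    covers : ∀ x → ∃₂ λ i (j : Fin (suc k)) → x ≈ s ^ toℕ j ∙ f (lookup leaders i)
    covers x with i , lead , x∼fi ← ∼-leader x with j , x≈ ← ∼-bounded x∼fi =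
      index i∈leaders , j , trans x≈ (∙-congˡ (reflexive (cong f (lookup-index i∈leaders))))
      where
      i∈leaders : i ∈ leaders
      i∈leaders = ∈-filter⁺ isLeader? (∈-allFin i) lead

module CayleyGraph {c ℓ p} (G : Group c ℓ) (S : Group.Carrier G → Set p)
  (connection : CayleyDefs.ConnectionSet G S) where
  open Group G
  open CayleyDefs G
  open ConnectionSet connection
  open GroupProperties G
  open import Algebra.Properties.Group G
  open import Relation.Binary.Reasoning.Setoid setoid

  S-nontrivial : ∀ {x} → S x → ¬ x ≈ ε
  S-nontrivial Sx x≈ε = no-identity (respects x≈ε Sx)

  Adj-sym : ∀ {x y} → Adj S x y → Adj S y x
  Adj-sym {x} {y} xy = respects (⁻¹-anti-homo-// x y) (inv-closed xy)

  Adj-∙ : ∀ {x y z} → y ≈ x ∙ z → S x → Adj S y z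
  Adj-∙ {x} {y} {z} y≈ Sx = respects (x≈z//y x z y (sym y≈)) Sx

  InducesCycle⇒IsCycle : ∀ k v → InducesCycle S k v → IsCycle S k v
  InducesCycle⇒IsCycle (suc k) v (2≤k , injective , adjacent) =
    2≤k , injective , λ i j next≡ → proj₂ (adjacent i j) (inj₁ next≡)

  edges-by-successor : ∀ {k} (v : Fin (suc k) → Carrier) (succ : Fin (suc k) → Fin (suc k)) →
                       (∀ i → next S i ≡ toℕ (succ i)) → (∀ i → Adj S (v i) (v (succ i))) →
                       ∀ i j → next S i ≡ toℕ j → Adj S (v i) (v j)
  edges-by-successor v succ next≡succ adjacent i j next≡j =
    subst (λ j → Adj S (v i) (v j)) (toℕ-injective (≡.trans (≡.sym (next≡succ i)) next≡j)) (adjacent i)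

  square : Carrier → Carrier → Fin 4 → Carrier
  square a b 0F = ε
  square a b 1F = a
  square a b 2F = b ∙ a
  square a b 3F = b

  square-successor : Fin 4 → Fin 4
  square-successor 0F = 1F
  square-successor 1F = 2F
  square-successor 2F = 3F
  square-successor 3F = 0F

  next-square-successor : ∀ i → next S i ≡ toℕ (square-successor i)
  next-square-successor 0F = ≡.refl
  next-square-successor 1F = ≡.refl
  next-square-successor 2F = ≡.refl
  next-square-successor 3F = ≡.refl

  module _ {a b} (Sa : S a) (Sb : S b) (a∙b≈b∙a : a ∙ b ≈ b ∙ a) where

    square-edges : ∀ i → Adj S (square a b i) (square a b (square-successor i))
    square-edges 0F = Adj-sym (Adj-∙ (sym (identityʳ a)) Sa)
    square-edges 1F = Adj-sym (Adj-∙ refl Sb)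
    square-edges 2F = Adj-∙ (sym a∙b≈b∙a) Sa
    square-edges 3F = Adj-∙ (sym (identityʳ b)) Sb

    square-injective : ¬ a ≈ b → ¬ a ≈ b ⁻¹ → ∀ i j → square a b i ≈ square a b j → i ≡ j
    square-injective a≉b a≉b⁻¹ = λ where
      0F 0F _ → ≡.refl
      0F 1F e → ⊥-elim (S-nontrivial Sa (sym e))
      0F 2F e → ⊥-elim (a≉b⁻¹ (inverseʳ-unique b a (sym e)))
      0F 3F e → ⊥-elim (S-nontrivial Sb (sym e))
      1F 0F e → ⊥-elim (S-nontrivial Sa e)
      1F 1F _ → ≡.refl
      1F 2F e → ⊥-elim (S-nontrivial Sb (identityˡ-unique b a (sym e)))
      1F 3F e → ⊥-elim (a≉b e)
      2F 0F e → ⊥-elim (a≉b⁻¹ (inverseʳ-unique b a e))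
      2F 1F e → ⊥-elim (S-nontrivial Sb (identityˡ-unique b a e))
      2F 2F _ → ≡.refl
      2F 3F e → ⊥-elim (S-nontrivial Sa (identityʳ-unique b a e))
      3F 0F e → ⊥-elim (S-nontrivial Sb e)
      3F 1F e → ⊥-elim (a≉b (sym e))
      3F 2F e → ⊥-elim (S-nontrivial Sa (identityʳ-unique b a (sym e)))
      3F 3F _ → ≡.refl

    square-isCycle : ¬ a ≈ b → ¬ a ≈ b ⁻¹ → IsCycle S 4 (square a b)
    square-isCycle a≉b a≉b⁻¹ = s≤s (s≤s z≤n) , square-injective a≉b a≉b⁻¹ ,
      edges-by-successor (square a b) square-successor next-square-successor square-edges

  commuting⇒≈∨≈⁻¹ : Decidable _≈_ → GirthGreaterThan S 4 →
                    ∀ {a b} → S a → S b → a ∙ b ≈ b ∙ a → a ≈ b ⊎ a ≈ b ⁻¹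
  commuting⇒≈∨≈⁻¹ _≟_ girth {a} {b} Sa Sb comm with a ≟ b | a ≟ (b ⁻¹)
  ... | yes a≈b | _        = inj₁ a≈b
  ... | no _    | yes a≈b⁻¹ = inj₂ a≈b⁻¹
  ... | no a≉b  | no a≉b⁻¹  =
    ⊥-elim (girth 4 ≤-refl (square a b , square-isCycle Sa Sb comm a≉b a≉b⁻¹))

  module PowersOfGenerator (_≟_ : Decidable _≈_) (girth : GirthGreaterThan S 4)
    {s k} (Ss : S s) (ord : HasOrder s (suc k)) where
    open Periodic {s} {k} (proj₁ (proj₂ ord))

    S∩⟨s⟩ : ∀ d → S (s ^ d) → s ^ d ≈ s ⊎ s ^ d ≈ s ⁻¹
    S∩⟨s⟩ d S^d = commuting⇒≈∨≈⁻¹ _≟_ girth S^d Ss (^-comm s d)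

    S∩⟨s⟩-// : ∀ a {b} → b ≤ suc k → S (s ^ a // s ^ b) →
               s ^ a // s ^ b ≈ s ⊎ s ^ a // s ^ b ≈ s ⁻¹
    S∩⟨s⟩-// a {b} b≤m S// =
      Sum.map (trans quotient) (trans quotient) (S∩⟨s⟩ (a + (suc k ∸ b)) (respects quotient S//))
      where
      quotient : s ^ a // s ^ b ≈ s ^ (a + (suc k ∸ b))
      quotient = ^-//-^ a b≤m

    next≡⇒ : ∀ {i j : Fin (suc k)} → next S i ≡ toℕ j → s ^ toℕ j ≈ s ∙ s ^ toℕ i
    next≡⇒ {i} {j} next≡ = begin
      s ^ toℕ j                  ≡⟨ cong (s ^_) next≡ ⟨
      s ^ (suc (toℕ i) % suc k)  ≈⟨ ^-%-period (suc (toℕ i)) ⟨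
      s ∙ s ^ toℕ i              ∎

    ⇒next≡ : ∀ {i j : Fin (suc k)} → s ^ toℕ j ≈ s ∙ s ^ toℕ i → next S i ≡ toℕ j
    ⇒next≡ {i} {j} eq = ^-injective ord (m%n<n (suc (toℕ i)) (suc k)) (toℕ<n j)
      (trans (sym (^-%-period (suc (toℕ i)))) (sym eq))

    coset : Carrier → Fin (suc k) → Carrier
    coset y j = s ^ toℕ j ∙ y

    coset-step : ∀ y i j → next S i ≡ toℕ j → coset y j ≈ s ∙ coset y i
    coset-step y i j next≡ = trans (∙-congʳ (next≡⇒ next≡)) (assoc _ _ _)

    coset-injective : ∀ y i j → coset y i ≈ coset y j → i ≡ j
    coset-injective y i j eq = toℕ-injective (^-injective ord (toℕ<n i) (toℕ<n j) (∙-cancelʳ y _ _ eq))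

    coset-adjacent⇒ : ∀ y i j → Adj S (coset y i) (coset y j) → next S i ≡ toℕ j ⊎ next S j ≡ toℕ i
    coset-adjacent⇒ y i j adj with S∩⟨s⟩-// (toℕ i) (<⇒≤ (toℕ<n j)) (respects (//-cancelʳ _ _ y) adj)
    ... | inj₁ quotient≈s   = inj₂ (⇒next≡ (//≈⇒≈∙ quotient≈s))
    ... | inj₂ quotient≈s⁻¹ = inj₁ (⇒next≡ (//≈⇒≈∙ (//≈⁻¹⇒//≈ quotient≈s⁻¹)))

    coset-adjacent⇐ : ∀ y i j → next S i ≡ toℕ j ⊎ next S j ≡ toℕ i → Adj S (coset y i) (coset y j)
    coset-adjacent⇐ y i j (inj₁ next≡) = Adj-sym (Adj-∙ (coset-step y i j next≡) Ss)
    coset-adjacent⇐ y i j (inj₂ next≡) = Adj-∙ (coset-step y j i next≡) Ss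

    coset-inducesCycle : 2 ≤ k → ∀ y → InducesCycle S (suc k) (coset y)
    coset-inducesCycle 2≤k y = 2≤k , coset-injective y ,
      λ i j → coset-adjacent⇒ y i j , coset-adjacent⇐ y i j

lemma2p3 : ∀ {c ℓ p : Level} (G : Group c ℓ) → CayleyDefs.IsFiniteGroup G
    → (S : Group.Carrier G → Set p) → CayleyDefs.ConnectionSet G S
    → CayleyDefs.GirthGreaterThan G S 4
    → (s : Group.Carrier G) → S s → (m : ℕ) → CayleyDefs.HasOrder G s m → 2 < m
    → CayleyDefs.GirthAtMost G S m × CayleyDefs.PartitionIntoInducedCycles G S m
lemma2p3 G finite S connection girth s Ss (suc k) ord 2<m =
  (suc k , ≤-refl , coset ε , InducesCycle⇒IsCycle (suc k) (coset ε) (induced ε)) ,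
  (size , (λ i → coset (rep i)) , (λ i → induced (rep i)) , covers , separates)
  where
  open Group G using (ε)
  open CayleyDefs G using (InducesCycle)
  open CayleyGraph G S connection
  open PowersOfGenerator (proj₁ finite) girth Ss ord
  open RightCosets.Transversal (RightCosets.transversal G finite {s} {k} (proj₁ (proj₂ ord)))

  induced : ∀ y → InducesCycle S (suc k) (coset y)
  induced = coset-inducesCycle (≤-pred 2<m)
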